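{- Let $M$ be a 3-connected matroid, and let $X$ and $Y$ be disjoint subsets of $E(M)$, where $X$ is a cosegment of $M$. If for some $x\in X$, $\sqcap(X-\{x\},Y)\geq 1$, then $X$ is a maximal member (under inclusion) of the class of all cosegments of $M$ that do not intersect $Y$.
   Context: A cosegment of $M$ is a set of elements every three-element subset of which is a triad (a 3-element cocircuit). For subsets $A,B$ of $E(M)$, $\sqcap(A,B)=r(A)+r(B)-r(A\cup B)$, where $r$ is the rank function of $M$. -}

module Defs where

open import Data.Nat using (ℕ; _≤_; _<_; _+_; _∸_)
open import Data.Fin using (Fin)
open import Data.Fin.Subset using (Subset; _⊆_; _⊂_; _∩_; _∪_; _─_; _-_; ∁; ⊤; ∣_∣; _∈_; _∉_)
open import Data.Product using (_×_)
open import Relation.Binary.PropositionalEquality using (_≡_)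
open import Relation.Nullary using (¬_)

-- A matroid on the finite ground set E(M) = Fin n, given by its rank
-- function (rank axioms R1–R3).
record Matroid (n : ℕ) : Set where
  field
    r       : Subset n → ℕ
    r-card  : ∀ A → r A ≤ ∣ A ∣
    r-mono  : ∀ {A B} → A ⊆ B → r A ≤ r B
    r-submod : ∀ A B → r (A ∪ B) + r (A ∩ B) ≤ r A + r B

module _ {n : ℕ} (M : Matroid n) where
  open Matroid M

  rM : ℕ
  rM = r ⊤

  -- (A, E - A) is a k-separation: |A| ≥ k, |E - A| ≥ k and
  -- λ(A) = r(A) + r(E - A) - r(M) < k   (written without subtraction)
  IsSeparation : ℕ → Subset n → Set
  IsSeparation k A = k ≤ ∣ A ∣ × k ≤ ∣ ∁ A ∣ × r A + r (∁ A) < rM + k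

  ThreeConnected : Set
  ThreeConnected = ∀ k → 1 ≤ k → k < 3 → ∀ A → ¬ IsSeparation k A

  -- dual rank r*(A) = |A| + r(E - A) - r(M)  (nonnegative, so ∸ is exact)
  r* : Subset n → ℕ
  r* A = ∣ A ∣ + r (∁ A) ∸ rM

  CoDependent : Subset n → Set
  CoDependent A = r* A < ∣ A ∣

  Cocircuit : Subset n → Set
  Cocircuit C = CoDependent C × (∀ D → D ⊂ C → ¬ CoDependent D)

  Triad : Subset n → Set
  Triad T = Cocircuit T × ∣ T ∣ ≡ 3

  Cosegment : Subset n → Set
  Cosegment X = ∀ T → T ⊆ X → ∣ T ∣ ≡ 3 → Triad T

  -- local connectivity ⊓(A,B) = r(A) + r(B) - r(A ∪ B)  (nonnegative)
  ⊓ : Subset n → Subset n → ℕ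
  ⊓ A B = r A + r B ∸ r (A ∪ B)

  Disjoint : Subset n → Subset n → Set
  Disjoint A B = ∀ {e} → e ∈ A → e ∉ B

  MaximalCosegmentAvoiding : Subset n → Subset n → Set
  MaximalCosegmentAvoiding Y X =
    Cosegment X × Disjoint X Y ×
    (∀ Z → Cosegment Z → Disjoint Z Y → X ⊆ Z → Z ⊆ X)

-- Suppose a cosegment Z ⊇ X avoiding Y has an element z ∉ X; put
-- D = {x, z} and A = X − x.  For every w ∈ A the set D ∪ {w} ⊆ Z is a
-- triad, so E − D is spanning (D is a proper subset of a cocircuit) while
-- E − (D ∪ {w}) is not (it is the complement of a cocircuit): every
-- element of A is a coloop of M \ D.  A set of coloops is a separator, so
-- r(A) + r(E − (A ∪ D)) ≤ r(M) = r(E − D) ≤ r(A ∪ (E − (A ∪ D))), that is,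
-- A is skew to E − (A ∪ D).  Skewness passes to subsets, and Y avoids
-- Z ⊇ A ∪ D, so ⊓(A, Y) = 0, a contradiction.  (If A is empty it has rank
-- 0 and ⊓(A, Y) = 0 directly.)
module Submission where

open import Defs
open import Data.Nat using (ℕ; _≤_)
open import Data.Fin using (Fin)
open import Data.Fin.Subset using (Subset; _∈_; _-_)
open import Data.Product using (Σ; _×_)

open import Data.Nat using (zero; suc; _+_; _∸_; _<_; z≤n; s≤s)
open import Data.Nat.Properties
  using ( ≤-refl; ≤-reflexive; ≤-trans; ≤-<-trans; ≤-pred; <⇒≤; <⇒≱; ≮⇒≥; n≤0⇒n≡0
        ; +-assoc; +-comm; m≤m+n; +-mono-≤; +-monoˡ-≤; +-monoʳ-≤; +-monoʳ-<
        ; +-cancelʳ-≤; +-cancelʳ-<; m+n∸n≡m; m≤n⇒m∸n≡0; m∸n≢0⇒n<m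
        ; ∸-cancelʳ-≤; ∸-cancelʳ-<; module ≤-Reasoning )
open import Data.Fin using (_≟_)
open import Data.Fin.Subset
  using (_∪_; _∩_; _─_; ∁; ⁅_⁆; ∣_∣; _∉_; _⊆_; _⊂_; Nonempty; inside; outside)
open import Data.Fin.Subset.Properties
open import Data.Product using (_,_; proj₁; proj₂)
open import Data.Sum using (_⊎_; inj₁; inj₂; [_,_])
open import Data.Vec.Base using (_∷_; here; there)
open import Data.Empty using (⊥-elim)
open import Function using (_∘_)
open import Relation.Nullary using (¬_; yes; no)
open import Relation.Binary.PropositionalEquality
  using (_≡_; _≢_; refl; sym; trans; cong; subst; module ≡-Reasoning)

+∸<⇒< : ∀ a b c → a + b ∸ c < a → b < c
+∸<⇒< a b c h = ∸-cancelʳ-< (subst (a + b ∸ c <_) (sym (m+n∸n≡m a b)) h)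

+∸≥⇒≥ : ∀ a b c → 1 ≤ a → a ≤ a + b ∸ c → c ≤ b
+∸≥⇒≥ a b c 1≤a a≤ =
  ∸-cancelʳ-≤ c≤a+b (subst (_≤ a + b ∸ c) (sym (m+n∸n≡m a b)) a≤)
  where
  c≤a+b : c ≤ a + b
  c≤a+b = <⇒≤ (m∸n≢0⇒n<m (λ eq → <⇒≱ (s≤s z≤n) (subst (1 ≤_) eq (≤-trans 1≤a a≤))))

x∈p─q⇒x∉q : ∀ {n} {x : Fin n} (p q : Subset n) → x ∈ p ─ q → x ∉ q
x∈p─q⇒x∉q {x = Fin.zero} (_ ∷ _) (inside ∷ _) () here
x∈p─q⇒x∉q {x = Fin.zero} (_ ∷ _) (outside ∷ _) _ ()
x∈p─q⇒x∉q (_ ∷ p) (_ ∷ q) (there x∈p─q) (there x∈q) = x∈p─q⇒x∉q p q x∈p─q x∈q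

x∉p∪q⁺ : ∀ {n} {x : Fin n} {p q : Subset n} → x ∉ p → x ∉ q → x ∉ p ∪ q
x∉p∪q⁺ {p = p} {q} x∉p x∉q = [ x∉p , x∉q ] ∘ x∈p∪q⁻ p q

x∉p∪q⁻ : ∀ {n} {x : Fin n} {p q : Subset n} → x ∉ p ∪ q → x ∉ p × x ∉ q
x∉p∪q⁻ x∉p∪q = x∉p∪q ∘ x∈p∪q⁺ ∘ inj₁ , x∉p∪q ∘ x∈p∪q⁺ ∘ inj₂

∪-lub : ∀ {n} {p q r : Subset n} → p ⊆ r → q ⊆ r → p ∪ q ⊆ r
∪-lub {p = p} {q} p⊆r q⊆r x∈p∪q = [ p⊆r , q⊆r ] (x∈p∪q⁻ p q x∈p∪q)

⁅x⁆⊆p : ∀ {n} {x : Fin n} {p : Subset n} → x ∈ p → ⁅ x ⁆ ⊆ p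
⁅x⁆⊆p {x = x} x∈p y∈⁅x⁆ = subst (_∈ _) (sym (x∈⁅y⁆⇒x≡y x y∈⁅x⁆)) x∈p

p⊆p-x∪⁅x⁆ : ∀ {n} (p : Subset n) (x : Fin n) → p ⊆ (p - x) ∪ ⁅ x ⁆
p⊆p-x∪⁅x⁆ p x {y} y∈p with y ≟ x
... | yes refl = x∈p∪q⁺ (inj₂ (x∈⁅x⁆ x))
... | no  y≢x  = x∈p∪q⁺ (inj₁ (x∈p∧x≢y⇒x∈p-y y∈p y≢x))

∣p∪⁅x⁆∣≡1+∣p∣ : ∀ {n} {x : Fin n} (p : Subset n) → x ∉ p → ∣ p ∪ ⁅ x ⁆ ∣ ≡ suc ∣ p ∣
∣p∪⁅x⁆∣≡1+∣p∣ {x = Fin.zero}  (outside ∷ p) _   = cong (suc ∘ ∣_∣) (∪-identityʳ p)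
∣p∪⁅x⁆∣≡1+∣p∣ {x = Fin.zero}  (inside  ∷ p) x∉p = ⊥-elim (x∉p here)
∣p∪⁅x⁆∣≡1+∣p∣ {x = Fin.suc x} (inside  ∷ p) x∉p = cong suc (∣p∪⁅x⁆∣≡1+∣p∣ p (x∉p ∘ there))
∣p∪⁅x⁆∣≡1+∣p∣ {x = Fin.suc x} (outside ∷ p) x∉p = ∣p∪⁅x⁆∣≡1+∣p∣ p (x∉p ∘ there)

nonempty⇒1≤∣p∣ : ∀ {n} {p : Subset n} → Nonempty p → 1 ≤ ∣ p ∣
nonempty⇒1≤∣p∣ (x , x∈p) = ≤-trans (s≤s z≤n) (x∈p⇒∣p-x∣<∣p∣ x∈p)

pair : ∀ {n} → Fin n → Fin n → Subset n
pair x z = ⁅ x ⁆ ∪ ⁅ z ⁆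

triple : ∀ {n} → Fin n → Fin n → Fin n → Subset n
triple x z w = pair x z ∪ ⁅ w ⁆

∈pair⁻ : ∀ {n} {x z e : Fin n} → e ∈ pair x z → e ≡ x ⊎ e ≡ z
∈pair⁻ {x = x} {z} e∈ with x∈p∪q⁻ ⁅ x ⁆ ⁅ z ⁆ e∈
... | inj₁ e∈⁅x⁆ = inj₁ (x∈⁅y⁆⇒x≡y x e∈⁅x⁆)
... | inj₂ e∈⁅z⁆ = inj₂ (x∈⁅y⁆⇒x≡y z e∈⁅z⁆)

pair⊆ : ∀ {n} {x z : Fin n} {p : Subset n} → x ∈ p → z ∈ p → pair x z ⊆ p
pair⊆ x∈p z∈p = ∪-lub (⁅x⁆⊆p x∈p) (⁅x⁆⊆p z∈p)

∣triple∣≡3 : ∀ {n} {x z w : Fin n} → x ≢ z → w ≢ x → w ≢ z → ∣ triple x z w ∣ ≡ 3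
∣triple∣≡3 {x = x} {z} {w} x≢z w≢x w≢z = begin
  ∣ pair x z ∪ ⁅ w ⁆ ∣  ≡⟨ ∣p∪⁅x⁆∣≡1+∣p∣ (pair x z) ([ w≢x , w≢z ] ∘ ∈pair⁻) ⟩
  suc ∣ ⁅ x ⁆ ∪ ⁅ z ⁆ ∣  ≡⟨ cong suc (∣p∪⁅x⁆∣≡1+∣p∣ ⁅ x ⁆ (x≢y⇒x∉⁅y⁆ (x≢z ∘ sym))) ⟩
  suc (suc ∣ ⁅ x ⁆ ∣)     ≡⟨ cong (suc ∘ suc) (∣⁅x⁆∣≡1 x) ⟩
  3                      ∎
  where open ≡-Reasoning

-- The two set inclusions behind one step of the coloop induction below:
-- with w ∈ S, B = E − ((S − w) ∪ D) and H = E − (D ∪ {w}) we have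
-- E − D ⊆ B ∪ H and E − (S ∪ D) ⊆ B ∩ H.
∁D⊆B∪H : ∀ {n} (S D : Subset n) (w : Fin n) → ∁ D ⊆ ∁ ((S - w) ∪ D) ∪ ∁ (D ∪ ⁅ w ⁆)
∁D⊆B∪H S D w {e} e∈∁D with e ≟ w
... | yes refl = x∈p∪q⁺ (inj₁ (x∉p⇒x∈∁p (x∉p∪q⁺ (λ w∈S-w → x∈p─q⇒x∉q S ⁅ w ⁆ w∈S-w (x∈⁅x⁆ w))
                                                 (x∈∁p⇒x∉p e∈∁D))))
... | no  e≢w  = x∈p∪q⁺ (inj₂ (x∉p⇒x∈∁p (x∉p∪q⁺ (x∈∁p⇒x∉p e∈∁D) (x≢y⇒x∉⁅y⁆ e≢w))))

∁S∪D⊆B∩H : ∀ {n} {S : Subset n} (D : Subset n) {w : Fin n} → w ∈ S →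
           ∁ (S ∪ D) ⊆ ∁ ((S - w) ∪ D) ∩ ∁ (D ∪ ⁅ w ⁆)
∁S∪D⊆B∩H {S = S} D {w} w∈S {e} e∈ = x∈p∩q⁺ (x∉p⇒x∈∁p e∉B , x∉p⇒x∈∁p e∉H)
  where
  e∉S : e ∉ S
  e∉S = proj₁ (x∉p∪q⁻ (x∈∁p⇒x∉p e∈))
  e∉D : e ∉ D
  e∉D = proj₂ (x∉p∪q⁻ (x∈∁p⇒x∉p e∈))
  e∉B : e ∉ (S - w) ∪ D
  e∉B = x∉p∪q⁺ (e∉S ∘ p─q⊆p S ⁅ w ⁆) e∉D
  e∉H : e ∉ D ∪ ⁅ w ⁆
  e∉H = x∉p∪q⁺ e∉D (λ e∈⁅w⁆ → e∉S (subst (_∈ S) (sym (x∈⁅y⁆⇒x≡y w e∈⁅w⁆)) w∈S))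

∁D⊆A∪∁[A∪D] : ∀ {n} (A D : Subset n) → ∁ D ⊆ A ∪ ∁ (A ∪ D)
∁D⊆A∪∁[A∪D] A D {e} e∈∁D with e ∈? A
... | yes e∈A = x∈p∪q⁺ (inj₁ e∈A)
... | no  e∉A = x∈p∪q⁺ (inj₂ (x∉p⇒x∈∁p (x∉p∪q⁺ e∉A (x∈∁p⇒x∉p e∈∁D))))

module RankFacts {n : ℕ} (M : Matroid n) where
  open Matroid M

  Spanning : Subset n → Set
  Spanning S = rM M ≤ r S

  -- A and B are skew: ⊓(A, B) = 0, written without truncated subtraction.
  Skew : Subset n → Subset n → Set
  Skew A B = r A + r B ≤ r (A ∪ B)

  skew⇒⊓≡0 : ∀ {A B} → Skew A B → ⊓ M A B ≡ 0
  skew⇒⊓≡0 = m≤n⇒m∸n≡0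

  rank-zero-skew : ∀ {A} B → r A ≡ 0 → Skew A B
  rank-zero-skew {A} B rA≡0 =
    subst (_≤ r (A ∪ B)) (cong (_+ r B) (sym rA≡0)) (r-mono (q⊆p∪q A B))

  -- If A is skew to C then A is skew to every subset Y of C (submodularity
  -- applied to A ∪ Y and C).
  skew-⊆ : ∀ {A C Y} → Skew A C → Y ⊆ C → Skew A Y
  skew-⊆ {A} {C} {Y} skewAC Y⊆C = +-cancelʳ-≤ (r C) (r A + r Y) (r (A ∪ Y)) (begin
    r A + r Y + r C                    ≡⟨ +-assoc (r A) (r Y) (r C) ⟩
    r A + (r Y + r C)                  ≡⟨ cong (r A +_) (+-comm (r Y) (r C)) ⟩
    r A + (r C + r Y)                  ≡⟨ +-assoc (r A) (r C) (r Y) ⟨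
    r A + r C + r Y                    ≤⟨ +-monoˡ-≤ (r Y) skewAC ⟩
    r (A ∪ C) + r Y                    ≤⟨ +-mono-≤ (r-mono A∪C⊆) (r-mono Y⊆) ⟩
    r ((A ∪ Y) ∪ C) + r ((A ∪ Y) ∩ C)  ≤⟨ r-submod (A ∪ Y) C ⟩
    r (A ∪ Y) + r C                    ∎)
    where
    open ≤-Reasoning
    A∪C⊆ : A ∪ C ⊆ (A ∪ Y) ∪ C
    A∪C⊆ = ∪-lub (p⊆p∪q C ∘ p⊆p∪q Y) (q⊆p∪q (A ∪ Y) C)
    Y⊆ : Y ⊆ (A ∪ Y) ∩ C
    Y⊆ y∈Y = x∈p∩q⁺ (q⊆p∪q A Y y∈Y , Y⊆C y∈Y)

  r-empty : ∀ {S} → ¬ Nonempty S → r S ≡ 0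
  r-empty {S} S-empty = n≤0⇒n≡0 (≤-trans (r-card S)
    (≤-reflexive (trans (cong ∣_∣ (Empty-unique S-empty)) (∣⊥∣≡0 n))))

  r-remove : ∀ S w → r S ≤ r (S - w) + 1
  r-remove S w = begin
    r S                                              ≤⟨ r-mono (p⊆p-x∪⁅x⁆ S w) ⟩
    r ((S - w) ∪ ⁅ w ⁆)                              ≤⟨ m≤m+n _ _ ⟩
    r ((S - w) ∪ ⁅ w ⁆) + r ((S - w) ∩ ⁅ w ⁆)        ≤⟨ r-submod (S - w) ⁅ w ⁆ ⟩
    r (S - w) + r ⁅ w ⁆                              ≤⟨ +-monoʳ-≤ (r (S - w)) r⁅w⁆≤1 ⟩
    r (S - w) + 1                                    ∎
    where
    open ≤-Reasoning
    r⁅w⁆≤1 : r ⁅ w ⁆ ≤ 1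
    r⁅w⁆≤1 = ≤-trans (r-card ⁅ w ⁆) (≤-reflexive (∣⁅x⁆∣≡1 w))

  nonspanning-cut : ∀ {B H} → r H < rM M → Spanning (B ∪ H) → r (B ∩ H) < r B
  nonspanning-cut {B} {H} rH<rM span = +-cancelʳ-< (r H) (r (B ∩ H)) (r B) (begin-strict
    r (B ∩ H) + r H          <⟨ +-monoʳ-< (r (B ∩ H)) rH<rM ⟩
    r (B ∩ H) + rM M         ≤⟨ +-monoʳ-≤ (r (B ∩ H)) span ⟩
    r (B ∩ H) + r (B ∪ H)    ≡⟨ +-comm (r (B ∩ H)) (r (B ∪ H)) ⟩
    r (B ∪ H) + r (B ∩ H)    ≤⟨ r-submod B H ⟩
    r B + r H                ∎)
    where open ≤-Reasoning

  -- w is a coloop of M \ D (for E − D spanning): E − (D ∪ {w}) is not spanning.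
  ColoopOutside : Subset n → Fin n → Set
  ColoopOutside D w = r (∁ (D ∪ ⁅ w ⁆)) < rM M

  -- S is a separator of M \ D: r(S) + r(E − (S ∪ D)) ≤ r(M).
  SeparatorOutside : Subset n → Subset n → Set
  SeparatorOutside D S = r S + r (∁ (S ∪ D)) ≤ rM M

  -- Removing one coloop: the rank of S drops by at most one while the rank
  -- of the rest drops by at least one (nonspanning-cut).
  separator-step : ∀ {D S w} → Spanning (∁ D) → w ∈ S → ColoopOutside D w →
                   SeparatorOutside D (S - w) → SeparatorOutside D S
  separator-step {D} {S} {w} span w∈S coloop IH = begin
    r S + r C                ≤⟨ +-monoˡ-≤ (r C) (r-remove S w) ⟩
    r (S - w) + 1 + r C      ≡⟨ +-assoc (r (S - w)) 1 (r C) ⟩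
    r (S - w) + suc (r C)    ≤⟨ +-monoʳ-≤ (r (S - w)) rC<rB ⟩
    r (S - w) + r B          ≤⟨ IH ⟩
    rM M                     ∎
    where
    open ≤-Reasoning
    B C : Subset n
    B = ∁ ((S - w) ∪ D)
    C = ∁ (S ∪ D)
    rC<rB : r C < r B
    rC<rB = ≤-<-trans (r-mono (∁S∪D⊆B∩H D w∈S))
              (nonspanning-cut coloop (≤-trans span (r-mono (∁D⊆B∪H S D w))))

  coloops-separate : ∀ {D} → Spanning (∁ D) → ∀ S →
                     (∀ {w} → w ∈ S → ColoopOutside D w) → SeparatorOutside D S
  coloops-separate {D} span S coloops = induct ∣ S ∣ S ≤-refl coloops
    where
    induct : ∀ m S → ∣ S ∣ ≤ m → (∀ {w} → w ∈ S → ColoopOutside D w) →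
             SeparatorOutside D S
    induct m S _ _ with nonempty? S
    induct m S _ _ | no S-empty =
      subst (_≤ rM M) (cong (_+ r (∁ (S ∪ D))) (sym (r-empty S-empty))) (r-mono ⊆⊤)
    induct zero S ∣S∣≤0 _ | yes (w , w∈S) =
      ⊥-elim (<⇒≱ (nonempty⇒1≤∣p∣ (w , w∈S)) ∣S∣≤0)
    induct (suc m) S ∣S∣≤1+m coloops | yes (w , w∈S) =
      separator-step span w∈S (coloops w∈S)
        (induct m (S - w) (≤-pred (≤-trans (x∈p⇒∣p-x∣<∣p∣ w∈S) ∣S∣≤1+m))
                (coloops ∘ p─q⊆p S ⁅ w ⁆))

  cocircuit⇒∁-nonspanning : ∀ {C} → Cocircuit M C → r (∁ C) < rM M
  cocircuit⇒∁-nonspanning {C} (codep , _) = +∸<⇒< ∣ C ∣ (r (∁ C)) (rM M) codep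

  cocircuit-⊂⇒∁-spanning : ∀ {C D} → Cocircuit M C → D ⊂ C → Nonempty D → Spanning (∁ D)
  cocircuit-⊂⇒∁-spanning {D = D} (_ , minimal) D⊂C D≠∅ =
    +∸≥⇒≥ ∣ D ∣ (r (∁ D)) (rM M) (nonempty⇒1≤∣p∣ D≠∅) (≮⇒≥ (minimal D D⊂C))

  module CosegmentTriple {Z : Subset n} (cosegZ : Cosegment M Z) {x z w : Fin n}
    (x∈Z : x ∈ Z) (z∈Z : z ∈ Z) (w∈Z : w ∈ Z)
    (x≢z : x ≢ z) (w≢x : w ≢ x) (w≢z : w ≢ z) where

    triad : Triad M (triple x z w)
    triad = cosegZ (triple x z w) (∪-lub (pair⊆ x∈Z z∈Z) (⁅x⁆⊆p w∈Z)) (∣triple∣≡3 x≢z w≢x w≢z)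

    ∁pair-spanning : Spanning (∁ (pair x z))
    ∁pair-spanning = cocircuit-⊂⇒∁-spanning (proj₁ triad) pair⊂triple (x , x∈pair)
      where
      x∈pair : x ∈ pair x z
      x∈pair = x∈p∪q⁺ (inj₁ (x∈⁅x⁆ x))
      pair⊂triple : pair x z ⊂ triple x z w
      pair⊂triple = p⊆p∪q ⁅ w ⁆ , w , q⊆p∪q (pair x z) ⁅ w ⁆ (x∈⁅x⁆ w) , [ w≢x , w≢z ] ∘ ∈pair⁻

    coloop : ColoopOutside (pair x z) w
    coloop = cocircuit⇒∁-nonspanning (proj₁ triad)

  cosegment-skew : ∀ {Z A : Subset n} {x z : Fin n} → Cosegment M Z →
                   x ∈ Z → z ∈ Z → x ≢ z → A ⊆ Z → x ∉ A → z ∉ A →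
                   Skew A (∁ (A ∪ pair x z))
  cosegment-skew {A = A} {x} {z} cosegZ x∈Z z∈Z x≢z A⊆Z x∉A z∉A with nonempty? A
  ... | no A-empty = rank-zero-skew (∁ (A ∪ pair x z)) (r-empty A-empty)
  ... | yes (w₀ , w₀∈A) = begin
    r A + r (∁ (A ∪ D))      ≤⟨ coloops-separate ∁D-spanning A coloops ⟩
    rM M                     ≤⟨ ∁D-spanning ⟩
    r (∁ D)                  ≤⟨ r-mono (∁D⊆A∪∁[A∪D] A D) ⟩
    r (A ∪ ∁ (A ∪ D))        ∎
    where
    open ≤-Reasoning
    D : Subset n
    D = pair x z
    module Triple {w} (w∈A : w ∈ A) =
      CosegmentTriple cosegZ x∈Z z∈Z (A⊆Z w∈A) x≢z
        (λ w≡x → x∉A (subst (_∈ A) w≡x w∈A)) (λ w≡z → z∉A (subst (_∈ A) w≡z w∈A))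
    ∁D-spanning : Spanning (∁ D)
    ∁D-spanning = Triple.∁pair-spanning w₀∈A
    coloops : ∀ {w} → w ∈ A → ColoopOutside D w
    coloops w∈A = Triple.coloop w∈A

open RankFacts

lemma3p7 : ∀ {n} (M : Matroid n) (X Y : Subset n) →
    ThreeConnected M → Disjoint M X Y → Cosegment M X →
    (x : Fin n) → x ∈ X → 1 ≤ ⊓ M (X - x) Y →
    MaximalCosegmentAvoiding M Y X
lemma3p7 M X Y _ X∩Y=∅ cosegX x x∈X 1≤⊓ = cosegX , X∩Y=∅ , maximal
  where
  -- A cosegment Z ⊇ X avoiding Y with some z ∉ X would make X − x skew to Y.
  maximal : ∀ Z → Cosegment M Z → Disjoint M Z Y → X ⊆ Z → Z ⊆ X
  maximal Z cosegZ Z∩Y=∅ X⊆Z {z} z∈Z with z ∈? X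
  ... | yes z∈X = z∈X
  ... | no  z∉X = ⊥-elim (<⇒≱ (subst (1 ≤_) ⊓≡0 1≤⊓) z≤n)
    where
    A : Subset _
    A = X - x
    A⊆X : A ⊆ X
    A⊆X = p─q⊆p X ⁅ x ⁆
    A∪D⊆Z : A ∪ pair x z ⊆ Z
    A∪D⊆Z = ∪-lub (X⊆Z ∘ A⊆X) (pair⊆ (X⊆Z x∈X) z∈Z)
    Y⊆∁[A∪D] : Y ⊆ ∁ (A ∪ pair x z)
    Y⊆∁[A∪D] y∈Y = x∉p⇒x∈∁p (λ y∈A∪D → Z∩Y=∅ (A∪D⊆Z y∈A∪D) y∈Y)
    skewAC : Skew M A (∁ (A ∪ pair x z))
    skewAC = cosegment-skew M cosegZ (X⊆Z x∈X) z∈Z (λ x≡z → z∉X (subst (_∈ X) x≡z x∈X))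
               (X⊆Z ∘ A⊆X) (λ x∈A → x∈p─q⇒x∉q X ⁅ x ⁆ x∈A (x∈⁅x⁆ x)) (z∉X ∘ A⊆X)
    ⊓≡0 : ⊓ M A Y ≡ 0
    ⊓≡0 = skew⇒⊓≡0 M (skew-⊆ M skewAC Y⊆∁[A∪D])
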